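{- Let $u^{(1)},\dots,u^{(k)}$ ($k\ge1$) be integer intervals in $[1,n]$ with $I_{maxl}=\max_i u^{(i)}_l$ and $I_{minr}=\min_i u^{(i)}_r$, let $D$ be any set of pawn-squares, and let $\rho=\bigl(\bigcap_i v_{u^{(i)}}\bigr)\setminus D$. Let $u=[u_l,u_r]\subseteq[1,n]$ be an interval with $v_u\cap\rho=\emptyset$ and $I_{minr}<u_l$. Then for every interval $\mu=[\mu_l,\mu_r]\subseteq[1,n]$ processed after $u$ (so that $u_l\le\mu_l$), $v_\mu\cap\rho=\emptyset$.
   Context: Board: $n\times n$, files and ranks numbered $1,\dots,n$. A pawn-square is a square $s$ at file $f$, rank $r$ with $2\le r\le n-1$; its set of potential starting files is $\mu_s=\{g\in\mathbb{Z}:\max(1,f-(r-2))\le g\le\min(n,f+(r-2))\}$. For an integer interval $u\subseteq[1,n]$, $v_u$ is the set of pawn-squares $s$ with $\mu_s\subseteq u$. Intervals are processed in lexicographic order of (left endpoint, right endpoint). -}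

module Defs where

open import Data.Nat using (ℕ; zero; suc; _+_; _∸_; _≤_; _<_; _⊔_; _⊓_)
open import Data.Fin using (Fin) renaming (zero to fzero; suc to fsuc)
open import Data.Product using (_×_; _,_; proj₁; proj₂)
open import Data.Sum using (_⊎_)
open import Relation.Binary.PropositionalEquality using (_≡_)
open import Relation.Nullary using (¬_)
open import Data.Empty using (⊥)

Interval : Set
Interval = ℕ × ℕ

left right : Interval → ℕ
left  = proj₁
right = proj₂

IsInterval : ℕ → Interval → Set
IsInterval n (l , r) = 1 ≤ l × l ≤ r × r ≤ n

-- A square is (file , rank).  Pawn-square: 1 ≤ f ≤ n, 2 ≤ r ≤ n-1.
Square : Set
Square = ℕ × ℕ

PawnSquare : ℕ → Square → Set
PawnSquare n (f , r) = 1 ≤ f × f ≤ n × 2 ≤ r × suc r ≤ n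

-- μ_s = [max(1, f-(r-2)) , min(n, f+(r-2))]  (truncated subtraction is
-- harmless on pawn-squares since max with 1 is taken)
μ-lo : ℕ → Square → ℕ
μ-lo n (f , r) = 1 ⊔ (f ∸ (r ∸ 2))

μ-hi : ℕ → Square → ℕ
μ-hi n (f , r) = n ⊓ (f + (r ∸ 2))

_∈μ[_]_ : ℕ → ℕ → Square → Set
g ∈μ[ n ] s = μ-lo n s ≤ g × g ≤ μ-hi n s

_∈I_ : ℕ → Interval → Set
g ∈I (l , r) = l ≤ g × g ≤ r

_∈v[_]_ : Square → ℕ → Interval → Set
s ∈v[ n ] u = PawnSquare n s × (∀ g → g ∈μ[ n ] s → g ∈I u)

InRho : ℕ → {k : ℕ} → (Fin k → Interval) → (Square → Set) → Square → Set
InRho n {k} us D s = (∀ (i : Fin k) → s ∈v[ n ] us i) × ¬ D s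

-- I_minr = min_i u^(i)_r  (value for k = 0 is irrelevant; k ≥ 1 is assumed)
Iminr : {k : ℕ} → (Fin k → Interval) → ℕ
Iminr {zero} us = 0
Iminr {suc zero} us = right (us fzero)
Iminr {suc (suc k)} us = right (us fzero) ⊓ Iminr (λ i → us (fsuc i))

Imaxl : {k : ℕ} → (Fin k → Interval) → ℕ
Imaxl {zero} us = 0
Imaxl {suc zero} us = left (us fzero)
Imaxl {suc (suc k)} us = left (us fzero) ⊔ Imaxl (λ i → us (fsuc i))

-- lexicographic processing order: u is processed strictly before μ
_≺_ : Interval → Interval → Set
(a , b) ≺ (c , d) = a < c ⊎ (a ≡ c × b < d)

DisjointVRho : ℕ → Interval → {k : ℕ} → (Fin k → Interval) → (Square → Set) → Set
DisjointVRho n u us D = ∀ (s : Square) → s ∈v[ n ] u → InRho n us D s → ⊥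

{-# OPTIONS --safe #-}
module Submission where

-- Every square s of ρ lies in each v_{u^(i)}, so its own file f, which belongs to μ_s,
-- satisfies f ≤ I_minr. A square of v_μ has f ≥ μ_l ≥ u_l > I_minr. Hence v_μ ∩ ρ = ∅
-- for every μ processed after u.

open import Defs
open import Data.Nat using (ℕ; _≤_; _<_; _∸_; suc)
open import Data.Nat.Properties
  using (⊔-lub; ⊓-glb; m∸n≤m; m≤m+n; <⇒≤; ≤-refl; ≤-trans; <-≤-trans; <⇒≱)
open import Data.Fin using (Fin) renaming (zero to fzero; suc to fsuc)
open import Data.Product using (_×_; _,_; proj₁; proj₂)
open import Data.Sum using (inj₁; inj₂)
open import Relation.Binary.PropositionalEquality using (refl)

file : Square → ℕ
file = proj₁

≤-Iminr : ∀ {k} (us : Fin (suc k) → Interval) {g : ℕ}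
  → (∀ i → g ≤ right (us i)) → g ≤ Iminr us
≤-Iminr {0}     us g≤ = g≤ fzero
≤-Iminr {suc k} us g≤ = ⊓-glb (g≤ fzero) (≤-Iminr (λ i → us (fsuc i)) (λ i → g≤ (fsuc i)))

≺⇒left≤ : ∀ {u μ : Interval} → u ≺ μ → left u ≤ left μ
≺⇒left≤ (inj₁ l<l′)       = <⇒≤ l<l′
≺⇒left≤ (inj₂ (refl , _)) = ≤-refl

file∈μ : ∀ {n} (s : Square) → PawnSquare n s → file s ∈μ[ n ] s
file∈μ (f , r) (1≤f , f≤n , _) = ⊔-lub 1≤f (m∸n≤m f (r ∸ 2)) , ⊓-glb f≤n (m≤m+n f (r ∸ 2))

∈v⇒file∈I : ∀ {n} {s : Square} {u : Interval} → s ∈v[ n ] u → file s ∈I u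
∈v⇒file∈I {s = s} (ps , μs⊆u) = μs⊆u (file s) (file∈μ s ps)

InRho⇒file≤Iminr : ∀ {n k} (us : Fin (suc k) → Interval) {D : Square → Set} {s : Square}
  → InRho n us D s → file s ≤ Iminr us
InRho⇒file≤Iminr us (s∈v , _) = ≤-Iminr us (λ i → proj₂ (∈v⇒file∈I (s∈v i)))

Iminr<left⇒DisjointVRho : ∀ n {k} (us : Fin (suc k) → Interval) (D : Square → Set)
  (μ : Interval) → Iminr us < left μ → DisjointVRho n μ us D
Iminr<left⇒DisjointVRho n us D μ Iminr<μₗ s s∈vμ s∈ρ =
  <⇒≱ Iminr<μₗ (≤-trans (proj₁ (∈v⇒file∈I s∈vμ)) (InRho⇒file≤Iminr us {D} s∈ρ))

theorem7 : (n k : ℕ) → 1 ≤ k → (us : Fin k → Interval)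
    → (∀ i → IsInterval n (us i))
    → (D : Square → Set)
    → (u : Interval) → IsInterval n u
    → DisjointVRho n u us D
    → Iminr us < left u
    → (μ : Interval) → IsInterval n μ → u ≺ μ
    → DisjointVRho n μ us D
theorem7 n (suc k) _ us _ D u _ _ Iminr<uₗ μ _ u≺μ =
  Iminr<left⇒DisjointVRho n us D μ (<-≤-trans Iminr<uₗ (≺⇒left≤ u≺μ))
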